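{- For $m\ge1$ define $\gamma_m\in S_{3m+2}$ by $$\gamma_m=3m+2,\ P_1,\ P_2,\ \dots,\ P_m,\ 2m+2,$$ where $P_i=2i,\ 3m+2-i,\ 2i-1$ for $1\le i\le m-1$ and $P_m=2m,\ 2m+1,\ 2m-1$ (so $\gamma_1=52314$, $\gamma_2=82714536$). Then (1) $\gamma_i$ is a pattern of $\gamma_{i+1}$ for every $i\ge1$; and (2) $\gamma_i$ is qlg-2-sortable if and only if $i$ is even.
   Context: The $\mathfrak{D}^2\mathfrak{I}$ machine: stacks $D_1,D_2$ (elements in decreasing order from top to bottom, top largest) followed by stack $I$ (elements in increasing order from top to bottom, top smallest). The input permutation is read left to right. Operations: $d_0$: push next input element into $D_1$; $d_1$: pop $D_1$, push into $D_2$; $d_2$: pop $D_2$, push into $I$; $d_3$: pop $I$ and append to the output. An operation is legal if it respects the stack order restrictions; $d_3$ is considered legal if it outputs the smallest element not yet output, or if no other operation is legal. The quasi left-greedy algorithm at each step performs the first legal operation in the priority order $d_3\rhd d_1\rhd d_0\rhd d_2$. A permutation of length $n$ is qlg-2-sortable if this algorithm produces output $12\cdots n$. $\sigma$ is a pattern of $\pi$ if $\pi$ has a subsequence order-isomorphic to $\sigma$. -}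

module Defs where

open import Data.Nat using (ℕ; zero; suc; _+_; _*_; _∸_; _<_; _<ᵇ_; _≡ᵇ_; _⊔_)
open import Data.Bool using (Bool; true; false; if_then_else_)
open import Data.List using (List; []; _∷_; _++_; length; map; concatMap; upTo; lookup; reverse; foldr)
open import Data.List.Relation.Binary.Sublist.Propositional using (_⊆_)
open import Data.Fin using (Fin; cast)
open import Data.Product using (Σ; _×_; _,_)
open import Function.Bundles using (_⇔_)
open import Relation.Binary.PropositionalEquality using (_≡_)

-- Permutations are lists of naturals (one-line notation, values 1..n).

OrderIso : List ℕ → List ℕ → Set
OrderIso σ τ =
  Σ (length σ ≡ length τ) λ eq →
    (i j : Fin (length σ)) →
      (lookup σ i < lookup σ j) ⇔ (lookup τ (cast eq i) < lookup τ (cast eq j))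

IsPattern : List ℕ → List ℕ → Set
IsPattern σ π = Σ (List ℕ) λ τ → (τ ⊆ π) × OrderIso σ τ

-- The permutations γ_m (intended for m ≥ 1)

P-block : ℕ → ℕ → List ℕ
P-block m i = 2 * i ∷ (3 * m + 2 ∸ i) ∷ (2 * i ∸ 1) ∷ []

P-last : ℕ → List ℕ
P-last m = 2 * m ∷ (2 * m + 1) ∷ (2 * m ∸ 1) ∷ []

gamma : ℕ → List ℕ
gamma m = (3 * m + 2) ∷ (concatMap (P-block m) (map suc (upTo (m ∸ 1)))
                          ++ P-last m ++ (2 * m + 2) ∷ [])

-- Stacks are lists with the top at the head.
-- D₁, D₂ : top largest (push x allowed iff stack empty or x > top).
-- I      : top smallest (push x allowed iff stack empty or x < top).

record State : Set where
  constructor st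
  field
    input : List ℕ
    d1    : List ℕ
    d2    : List ℕ
    i     : List ℕ
    out   : List ℕ     -- output so far, most recent element first

open State

pushDec : ℕ → List ℕ → Bool
pushDec x []      = true
pushDec x (y ∷ _) = y <ᵇ x

pushInc : ℕ → List ℕ → Bool
pushInc x []      = true
pushInc x (y ∷ _) = x <ᵇ y

minFrom : ℕ → List ℕ → ℕ
minFrom x []       = x
minFrom x (y ∷ ys) = if y <ᵇ x then minFrom y ys else minFrom x ys

isSmallestRemaining : ℕ → State → Bool
isSmallestRemaining x s = minFrom x (input s ++ d1 s ++ d2 s ++ i s) ≡ᵇ x

fallback3 : State → Bool × State
fallback3 s@(st inp D1 D2 []       O) = false , s
fallback3   (st inp D1 D2 (x ∷ I') O) = true , st inp D1 D2 I' (x ∷ O)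

try2 : State → Bool × State
try2 s@(st inp D1 []        I O) = fallback3 s
try2 s@(st inp D1 (x ∷ D2') I O) =
  if pushInc x I then (true , st inp D1 D2' (x ∷ I) O) else fallback3 s

try0 : State → Bool × State
try0 s@(st []         D1 D2 I O) = try2 s
try0 s@(st (x ∷ inp') D1 D2 I O) =
  if pushDec x D1 then (true , st inp' (x ∷ D1) D2 I O) else try2 s

try1 : State → Bool × State
try1 s@(st inp []        D2 I O) = try0 s
try1 s@(st inp (x ∷ D1') D2 I O) =
  if pushDec x D2 then (true , st inp D1' (x ∷ D2) I O) else try0 s

-- one step of the quasi left-greedy algorithm, priority d₃ ▷ d₁ ▷ d₀ ▷ d₂,
-- where d₃ is first tried only if it outputs the smallest element not yet
-- output, and finally (fallback3) if no other operation is legal.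
-- The Boolean is false iff no operation is legal (the algorithm halts).
step : State → Bool × State
step s@(st inp D1 D2 []       O) = try1 s
step s@(st inp D1 D2 (x ∷ I') O) =
  if isSmallestRemaining x s then (true , st inp D1 D2 I' (x ∷ O)) else try1 s

run : ℕ → State → State
run zero    s = s
run (suc k) s with step s
... | false , s' = s'
... | true  , s' = run k s'

-- each element undergoes at most 4 operations, so 4n steps suffice
qlgOutput : List ℕ → List ℕ
qlgOutput π = reverse (out (run (4 * length π) (st π [] [] [] [])))

idPerm : ℕ → List ℕ
idPerm n = map suc (upTo n)

QlgSortable : List ℕ → Set
QlgSortable π = qlgOutput π ≡ idPerm (length π)

-- (1) Deleting the block P_{n+1} = 2n+2, 2n+7, 2n+1 from γ_{n+2} leaves γ_{n+1} with the three values
-- 2n+1, 2n+2, 2n+7 punched in, a strictly monotone relabelling.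
-- (2) The algorithm is traced symbolically. After the leading entry and the first j pairs of blocks
-- P_{2i-1} P_{2i} have been read, nothing has been output, D₁ holds the odd numbers below 4j, D₂ the
-- smallest large entry read so far on top of the even numbers up to 4j, and I the large entries above it.
-- For even m the remaining input P_{m-1} P_m (2m+2) completes this pattern, after which the stacks unload
-- into I in sorted order and are output as 1, 2, …, 3m+2. For odd m only P_m (2m+2) is left; after it
-- 2m+1 is on top of I while 2m-1 is still in D₁, no operation but d₃ is legal, and 2m+1 is output first.

module Submission where

open import Data.Bool using (Bool; true; false; if_then_else_; T)
open import Data.Empty using (⊥-elim)
open import Data.List
  using (List; []; _∷_; _++_; _ʳ++_; length; map; reverse; concatMap; upTo; applyUpTo; lookup)
open import Data.List.Membership.Propositional using (_∈_)
open import Data.List.Membership.Propositional.Properties using (∈-++⁺ˡ; ∈-++⁺ʳ)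
open import Data.List.Relation.Unary.All as All using (All; []; _∷_)
open import Data.List.Relation.Unary.Any using (here; there)
open import Data.Nat using (ℕ; zero; suc; _+_; _*_; _∸_; _≤_; _<_; _<ᵇ_; _≡ᵇ_; z≤n; s≤s; s<s; _<?_)
open import Data.Nat.Properties
open import Data.List.Properties
  using ( ++-assoc; map-++; concatMap-++; reverse-++; reverse-involutive; ∷-injectiveˡ
        ; map-upTo; upTo-∷ʳ; length-++; length-map; length-upTo)
open import Data.List.Relation.Unary.All.Properties using (applyUpTo⁺₁)
open import Data.List.Relation.Binary.Sublist.Propositional using (_⊆_; _∷_; ⊆-refl)
open import Data.List.Relation.Binary.Sublist.Propositional.Properties using (++⁺; ++⁺ˡ)
open import Data.Nat.Divisibility using (_∣_; divides; ∣1⇒≡1; ∣m+n∣m⇒∣n; n∣m*n)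
open import Data.Nat.Tactic.RingSolver using (solve-∀)
open import Data.Product using (∃; _×_; _,_; proj₂)
open import Function using (_∘_; _⇔_; mk⇔)
open import Data.Fin using (cast)
import Data.Fin as Fin
open import Relation.Binary.Core using (_Preserves_⟶_)
open import Relation.Binary.Definitions using (tri<; tri≈; tri>)
open import Relation.Binary.Construct.Closure.ReflexiveTransitive using (Star; ε; _◅_; _◅◅_)
open import Relation.Binary.PropositionalEquality
open import Relation.Nullary using (¬_; yes; no)

open import Defs

<⇒<ᵇ≡true : ∀ {m n} → m < n → (m <ᵇ n) ≡ true
<⇒<ᵇ≡true {zero}  {suc n} _       = refl
<⇒<ᵇ≡true {suc m} {suc n} (s≤s p) = <⇒<ᵇ≡true p

≥⇒<ᵇ≡false : ∀ {m n} → n ≤ m → (m <ᵇ n) ≡ false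
≥⇒<ᵇ≡false {m}     {zero}  _       = refl
≥⇒<ᵇ≡false {suc m} {suc n} (s≤s p) = ≥⇒<ᵇ≡false p

≡ᵇ-refl : ∀ m → (m ≡ᵇ m) ≡ true
≡ᵇ-refl zero    = refl
≡ᵇ-refl (suc m) = ≡ᵇ-refl m

<⇒≡ᵇ≡false : ∀ {m n} → m < n → (m ≡ᵇ n) ≡ false
<⇒≡ᵇ≡false {zero}  {suc n} _       = refl
<⇒≡ᵇ≡false {suc m} {suc n} (s≤s p) = <⇒≡ᵇ≡false p

-- The implicit argument is solved by evaluation on numerals: offset-< b 3 5 : 3 + b < 5 + b.
offset-< : ∀ b m n → {T (m <ᵇ n)} → m + b < n + b
offset-< b m n {m<ᵇn} = +-monoˡ-< b (<ᵇ⇒< m n m<ᵇn)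

minFrom-≤-seed : ∀ x L → minFrom x L ≤ x
minFrom-≤-seed x []      = ≤-refl
minFrom-≤-seed x (y ∷ L) with y <ᵇ x in y<ᵇx
... | true  = ≤-trans (minFrom-≤-seed y L) (<⇒≤ (<ᵇ⇒< y x (subst T (sym y<ᵇx) _)))
... | false = minFrom-≤-seed x L

minFrom-≤-∈ : ∀ x L {y} → y ∈ L → minFrom x L ≤ y
minFrom-≤-∈ x (y ∷ L) (here refl) with y <ᵇ x in y<ᵇx
... | true  = minFrom-≤-seed y L
... | false = ≤-trans (minFrom-≤-seed x L) (≮⇒≥ λ y<x → subst T y<ᵇx (<⇒<ᵇ y<x))
minFrom-≤-∈ x (z ∷ L) (there y∈L) with z <ᵇ x
... | true  = minFrom-≤-∈ z L y∈L
... | false = minFrom-≤-∈ x L y∈L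

minFrom-≡-seed : ∀ x L → All (x ≤_) L → minFrom x L ≡ x
minFrom-≡-seed x []      []         = refl
minFrom-≡-seed x (y ∷ L) (x≤y ∷ ps) rewrite ≥⇒<ᵇ≡false {y} {x} x≤y = minFrom-≡-seed x L ps

remaining : State → List ℕ
remaining s = input s ++ d1 s ++ d2 s ++ i s
  where open State

isSmallestRemaining-true : ∀ x s → All (x ≤_) (remaining s) → isSmallestRemaining x s ≡ true
isSmallestRemaining-true x s p rewrite minFrom-≡-seed x (remaining s) p = ≡ᵇ-refl x

isSmallestRemaining-false : ∀ x s {w} → w ∈ remaining s → w < x → isSmallestRemaining x s ≡ false
isSmallestRemaining-false x s w∈ w<x = <⇒≡ᵇ≡false (≤-<-trans (minFrom-≤-∈ x (remaining s) w∈) w<x)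

-- Runs of the machine

-- An entry in the input still has to pass D₁, D₂, I and the output, so every operation lowers work by
-- one; in particular the fuel 4n of qlgOutput is exactly the work of the initial state.
work : State → ℕ
work (st inp D1 D2 I _) = length I + 2 * length D2 + 3 * length D1 + 4 * length inp

record Step (s s′ : State) : Set where
  constructor steps
  field
    fires    : step s ≡ (true , s′)
    consumes : work s ≡ suc (work s′)

infix 4 _↠_
_↠_ : State → State → Set
_↠_ = Star Step

run-↠ : ∀ {s s′} → s ↠ s′ → run (work s) s ≡ run (work s′) s′
run-↠ ε                  = refl
run-↠ (steps fires consumes ◅ s′↠) rewrite consumes | fires = run-↠ s′↠

eager₃ legal₁ legal₀ legal₂ : State → Bool
eager₃ (st inp D1 D2 []      O)    = false
eager₃ s@(st inp D1 D2 (x ∷ I) O) = isSmallestRemaining x s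
legal₁ (st inp []       D2 I O)    = false
legal₁ (st inp (x ∷ D1) D2 I O)    = pushDec x D2
legal₀ (st []        D1 D2 I O)    = false
legal₀ (st (x ∷ inp) D1 D2 I O)    = pushDec x D1
legal₂ (st inp D1 []       I O)    = false
legal₂ (st inp D1 (x ∷ D2) I O)    = pushInc x I

step≡try1 : ∀ s → eager₃ s ≡ false → step s ≡ try1 s
step≡try1 (st inp D1 D2 []      O) _ = refl
step≡try1 (st inp D1 D2 (x ∷ I) O) h rewrite h = refl

try1≡try0 : ∀ s → legal₁ s ≡ false → try1 s ≡ try0 s
try1≡try0 (st inp []       D2 I O) _ = refl
try1≡try0 (st inp (x ∷ D1) D2 I O) h rewrite h = refl

try0≡try2 : ∀ s → legal₀ s ≡ false → try0 s ≡ try2 s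
try0≡try2 (st []        D1 D2 I O) _ = refl
try0≡try2 (st (x ∷ inp) D1 D2 I O) h rewrite h = refl

try2≡fallback3 : ∀ s → legal₂ s ≡ false → try2 s ≡ fallback3 s
try2≡fallback3 (st inp D1 []       I O) _ = refl
try2≡fallback3 (st inp D1 (x ∷ D2) I O) h rewrite h = refl

module _ {inp D1 D2 I O : List ℕ} {x : ℕ} where

  step-d₃ : isSmallestRemaining x (st inp D1 D2 (x ∷ I) O) ≡ true →
            Step (st inp D1 D2 (x ∷ I) O) (st inp D1 D2 I (x ∷ O))
  step-d₃ h = steps fires refl
    where
    fires : step (st inp D1 D2 (x ∷ I) O) ≡ (true , st inp D1 D2 I (x ∷ O))
    fires rewrite h = refl

  step-d₁ : let s = st inp (x ∷ D1) D2 I O in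
            eager₃ s ≡ false → pushDec x D2 ≡ true → Step s (st inp D1 (x ∷ D2) I O)
  step-d₁ h₃ h = steps fires (work-eq (length I) (length D2) (length D1) (length inp))
    where
    s : State
    s = st inp (x ∷ D1) D2 I O
    fires : step s ≡ (true , st inp D1 (x ∷ D2) I O)
    fires rewrite step≡try1 s h₃ | h = refl
    work-eq : ∀ a b c d → a + 2 * b + 3 * suc c + 4 * d ≡ suc (a + 2 * suc b + 3 * c + 4 * d)
    work-eq = solve-∀

  step-d₀ : let s = st (x ∷ inp) D1 D2 I O in
            eager₃ s ≡ false → legal₁ s ≡ false → pushDec x D1 ≡ true →
            Step s (st inp (x ∷ D1) D2 I O)
  step-d₀ h₃ h₁ h = steps fires (work-eq (length I) (length D2) (length D1) (length inp))
    where
    s : State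
    s = st (x ∷ inp) D1 D2 I O
    fires : step s ≡ (true , st inp (x ∷ D1) D2 I O)
    fires rewrite step≡try1 s h₃ | try1≡try0 s h₁ | h = refl
    work-eq : ∀ a b c d → a + 2 * b + 3 * c + 4 * suc d ≡ suc (a + 2 * b + 3 * suc c + 4 * d)
    work-eq = solve-∀

  step-d₂ : let s = st inp D1 (x ∷ D2) I O in
            eager₃ s ≡ false → legal₁ s ≡ false → legal₀ s ≡ false → pushInc x I ≡ true →
            Step s (st inp D1 D2 (x ∷ I) O)
  step-d₂ h₃ h₁ h₀ h = steps fires (work-eq (length I) (length D2) (length D1) (length inp))
    where
    s : State
    s = st inp D1 (x ∷ D2) I O
    fires : step s ≡ (true , st inp D1 D2 (x ∷ I) O)
    fires rewrite step≡try1 s h₃ | try1≡try0 s h₁ | try0≡try2 s h₀ | h = refl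
    work-eq : ∀ a b c d → a + 2 * suc b + 3 * c + 4 * d ≡ suc (suc a + 2 * b + 3 * c + 4 * d)
    work-eq = solve-∀

  step-d₃-forced : let s = st inp D1 D2 (x ∷ I) O in
                   eager₃ s ≡ false → legal₁ s ≡ false → legal₀ s ≡ false → legal₂ s ≡ false →
                   Step s (st inp D1 D2 I (x ∷ O))
  step-d₃-forced h₃ h₁ h₀ h₂ = steps fires refl
    where
    s : State
    s = st inp D1 D2 (x ∷ I) O
    fires : step s ≡ (true , st inp D1 D2 I (x ∷ O))
    fires rewrite step≡try1 s h₃ | try1≡try0 s h₁ | try0≡try2 s h₀ | try2≡fallback3 s h₂
      = refl

OutGrows : State → State → Set
OutGrows s s′ = ∃ λ xs → State.out s′ ≡ xs ++ State.out s

fallback3-grows : ∀ s → OutGrows s (proj₂ (fallback3 s))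
fallback3-grows (st inp D1 D2 []      O) = [] , refl
fallback3-grows (st inp D1 D2 (x ∷ I) O) = x ∷ [] , refl

try2-grows : ∀ s → OutGrows s (proj₂ (try2 s))
try2-grows s@(st inp D1 []       I O) = fallback3-grows s
try2-grows s@(st inp D1 (x ∷ D2) I O) with pushInc x I
... | true  = [] , refl
... | false = fallback3-grows s

try0-grows : ∀ s → OutGrows s (proj₂ (try0 s))
try0-grows s@(st []        D1 D2 I O) = try2-grows s
try0-grows s@(st (x ∷ inp) D1 D2 I O) with pushDec x D1
... | true  = [] , refl
... | false = try2-grows s

try1-grows : ∀ s → OutGrows s (proj₂ (try1 s))
try1-grows s@(st inp []       D2 I O) = try0-grows s
try1-grows s@(st inp (x ∷ D1) D2 I O) with pushDec x D2
... | true  = [] , refl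
... | false = try0-grows s

step-grows : ∀ s → OutGrows s (proj₂ (step s))
step-grows s@(st inp D1 D2 []      O) = try1-grows s
step-grows s@(st inp D1 D2 (x ∷ I) O) with isSmallestRemaining x s
... | true  = x ∷ [] , refl
... | false = try1-grows s

run-grows : ∀ k s → OutGrows s (run k s)
run-grows zero    s = [] , refl
run-grows (suc k) s with step s | step-grows s
... | false , s′ | grows = grows
... | true  , s′ | xs , eq with run-grows k s′
...   | ys , eq′ = ys ++ xs , trans eq′ (trans (cong (ys ++_) eq) (sym (++-assoc ys xs _)))

qlgOutput-↠ : ∀ π {s} → st π [] [] [] [] ↠ s → qlgOutput π ≡ reverse (State.out (run (work s) s))
qlgOutput-↠ π r = cong (reverse ∘ State.out) (run-↠ r)

qlgOutput-prefix : ∀ π {s} → st π [] [] [] [] ↠ s → ∃ λ ys → qlgOutput π ≡ reverse (State.out s) ++ ys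
qlgOutput-prefix π {s} r with run-grows (work s) s
... | xs , eq =
  reverse xs , trans (qlgOutput-↠ π r) (trans (cong reverse eq) (reverse-++ xs (State.out s)))

-- Unlike w ∈ remaining s, this family determines the state by unification, so the traces below
-- need not spell out intermediate states.
data Remains (w : ℕ) : State → Set where
  in-input : ∀ {inp D1 D2 I O} → w ∈ inp → Remains w (st inp D1 D2 I O)
  in-d₁    : ∀ {inp D1 D2 I O} → w ∈ D1  → Remains w (st inp D1 D2 I O)
  in-d₂    : ∀ {inp D1 D2 I O} → w ∈ D2  → Remains w (st inp D1 D2 I O)

Remains⇒∈remaining : ∀ {w s} → Remains w s → w ∈ remaining s
Remains⇒∈remaining (in-input w∈)         = ∈-++⁺ˡ w∈
Remains⇒∈remaining (in-d₁ {inp} w∈)      = ∈-++⁺ʳ inp (∈-++⁺ˡ w∈)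
Remains⇒∈remaining (in-d₂ {inp} {D1} w∈) = ∈-++⁺ʳ inp (∈-++⁺ʳ D1 (∈-++⁺ˡ w∈))

eager₃-false : ∀ {inp D1 D2 I O} w → Remains w (st inp D1 D2 I O) → All (w <_) I →
               eager₃ (st inp D1 D2 I O) ≡ false
eager₃-false {I = []}    w _  _         = refl
eager₃-false {inp} {D1} {D2} {x ∷ I} {O} w w∈ (w<x ∷ _) =
  isSmallestRemaining-false x (st inp D1 D2 (x ∷ I) O) (Remains⇒∈remaining w∈) w<x

legal₁-false : ∀ {inp D1 z D2 I O} → All (_< z) D1 → legal₁ (st inp D1 (z ∷ D2) I O) ≡ false
legal₁-false []        = refl
legal₁-false (y<z ∷ _) = ≥⇒<ᵇ≡false (<⇒≤ y<z)

pushDec-true : ∀ {x D} → All (_< x) D → pushDec x D ≡ true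
pushDec-true []        = refl
pushDec-true (y<x ∷ _) = <⇒<ᵇ≡true y<x

pushInc-true : ∀ {x I} → All (x <_) I → pushInc x I ≡ true
pushInc-true []        = refl
pushInc-true (x<y ∷ _) = <⇒<ᵇ≡true x<y

-- In each of the following, w is a remaining element below the top of I, so d₃ does not fire eagerly.
module _ (w : ℕ) where

  d₀-fires : ∀ {x inp D1 z D2 I O} → let s = st (x ∷ inp) D1 (z ∷ D2) I O in
             Remains w s → All (w <_) I → All (_< z) D1 → All (_< x) D1 →
             Step s (st inp (x ∷ D1) (z ∷ D2) I O)
  d₀-fires w∈ w<I D1<z D1<x = step-d₀ (eager₃-false w w∈ w<I) (legal₁-false D1<z) (pushDec-true D1<x)

  d₁-fires : ∀ {inp y D1 D2 I O} → let s = st inp (y ∷ D1) D2 I O in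
             Remains w s → All (w <_) I → pushDec y D2 ≡ true →
             Step s (st inp D1 (y ∷ D2) I O)
  d₁-fires w∈ w<I = step-d₁ (eager₃-false w w∈ w<I)

  d₂-fires : ∀ {inp D1 z D2 I O} → let s = st inp D1 (z ∷ D2) I O in
             Remains w s → All (w <_) I → All (_< z) D1 → legal₀ s ≡ false → All (z <_) I →
             Step s (st inp D1 D2 (z ∷ I) O)
  d₂-fires w∈ w<I D1<z no₀ z<I =
    step-d₂ (eager₃-false w w∈ w<I) (legal₁-false D1<z) no₀ (pushInc-true z<I)

  d₃-forced-fires : ∀ {inp D1 D2 x I O} → let s = st inp D1 D2 (x ∷ I) O in
                    Remains w s → All (w <_) (x ∷ I) →
                    legal₁ s ≡ false → legal₀ s ≡ false → legal₂ s ≡ false →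
                    Step s (st inp D1 D2 I (x ∷ O))
  d₃-forced-fires w∈ w<I = step-d₃-forced (eager₃-false w w∈ w<I)

-- The run on γ_m

-- A block pair P_{2j+1} P_{2j+2} = x₁ y₁ z₁ x₂ y₂ z₂ is consumed in two stages; the first stage also
-- ends the run in the odd case, where x₂ = 2m + 2 is the last input.
block₁↠ : ∀ {x₁ y₁ z₁ x₂ rest D1 t D2 I O} →
          All (_< z₁) D1 → All (_< x₁) D2 → All (t <_) I →
          z₁ < x₁ → x₁ < y₁ → y₁ < t → z₁ < x₂ → x₁ < x₂ →
          st (x₁ ∷ y₁ ∷ z₁ ∷ x₂ ∷ rest) D1 (t ∷ D2) I O ↠ st rest (z₁ ∷ D1) (x₂ ∷ x₁ ∷ D2) (y₁ ∷ t ∷ I) O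
block₁↠ {x₁} {y₁} {z₁} {x₂} {D1 = D1} {t} {I = I} D1<z₁ D2<x₁ t<I z₁<x₁ x₁<y₁ y₁<t z₁<x₂ x₁<x₂ =
  d₀-fires z₁ (in-input (there (there (here refl)))) z₁<I D1<t D1<x₁ ◅
  d₀-fires z₁ (in-input (there (here refl))) z₁<I (x₁<t ∷ D1<t) (x₁<y₁ ∷ D1<y₁) ◅
  d₂-fires z₁ (in-input (here refl)) z₁<I (y₁<t ∷ x₁<t ∷ D1<t) (≥⇒<ᵇ≡false (<⇒≤ z₁<y₁)) t<I ◅
  d₁-fires z₁ (in-input (here refl)) (z₁<t ∷ z₁<I) (pushDec-true (All.map (λ p → <-trans p x₁<y₁) D2<x₁)) ◅
  d₂-fires z₁ (in-input (here refl)) (z₁<t ∷ z₁<I) (x₁<y₁ ∷ D1<y₁) (≥⇒<ᵇ≡false (<⇒≤ z₁<x₁))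
           (y₁<t ∷ All.map (<-trans y₁<t) t<I) ◅
  d₁-fires z₁ (in-input (here refl)) (z₁<y₁ ∷ z₁<t ∷ z₁<I) (pushDec-true D2<x₁) ◅
  d₀-fires z₁ (in-input (here refl)) (z₁<y₁ ∷ z₁<t ∷ z₁<I) D1<x₁ D1<z₁ ◅
  d₀-fires z₁ (in-d₁ (here refl)) (z₁<y₁ ∷ z₁<t ∷ z₁<I) (z₁<x₁ ∷ D1<x₁)
           (z₁<x₂ ∷ All.map (λ p → <-trans p z₁<x₂) D1<z₁) ◅
  d₁-fires z₁ (in-d₁ (there (here refl))) (z₁<y₁ ∷ z₁<t ∷ z₁<I) (<⇒<ᵇ≡true x₁<x₂) ◅
  ε
  where
  x₁<t : x₁ < t
  x₁<t = <-trans x₁<y₁ y₁<t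
  z₁<y₁ : z₁ < y₁
  z₁<y₁ = <-trans z₁<x₁ x₁<y₁
  z₁<t : z₁ < t
  z₁<t = <-trans z₁<y₁ y₁<t
  z₁<I : All (z₁ <_) I
  z₁<I = All.map (<-trans z₁<t) t<I
  D1<x₁ : All (_< x₁) D1
  D1<x₁ = All.map (λ p → <-trans p z₁<x₁) D1<z₁
  D1<y₁ : All (_< y₁) D1
  D1<y₁ = All.map (λ p → <-trans p x₁<y₁) D1<x₁
  D1<t : All (_< t) D1
  D1<t = All.map (λ p → <-trans p y₁<t) D1<y₁

block₂↠ : ∀ {y₂ z₂ rest z₁ D1 x₂ x₁ D2 y₁ t I O} →
          All (_< z₁) D1 → z₁ < y₁ → y₁ < t → All (t <_) I → z₁ < x₂ → x₂ < y₂ → z₁ < z₂ →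
          st (y₂ ∷ z₂ ∷ rest) (z₁ ∷ D1) (x₂ ∷ x₁ ∷ D2) (y₁ ∷ t ∷ I) O ↠
          st rest (z₂ ∷ z₁ ∷ D1) (y₂ ∷ x₂ ∷ x₁ ∷ D2) (y₁ ∷ t ∷ I) O
block₂↠ {y₂} {z₂} {z₁ = z₁} {D1} {y₁ = y₁} {t} {I} D1<z₁ z₁<y₁ y₁<t t<I z₁<x₂ x₂<y₂ z₁<z₂ =
  d₀-fires z₁ (in-d₁ (here refl)) z₁<I (z₁<x₂ ∷ below z₁<x₂) (z₁<y₂ ∷ below z₁<y₂) ◅
  d₁-fires z₁ (in-d₁ (there (here refl))) z₁<I (<⇒<ᵇ≡true x₂<y₂) ◅
  d₀-fires z₁ (in-d₁ (here refl)) z₁<I (z₁<y₂ ∷ below z₁<y₂) (z₁<z₂ ∷ below z₁<z₂) ◅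
  ε
  where
  z₁<y₂ : z₁ < y₂
  z₁<y₂ = <-trans z₁<x₂ x₂<y₂
  z₁<t : z₁ < t
  z₁<t = <-trans z₁<y₁ y₁<t
  z₁<I : All (z₁ <_) (y₁ ∷ t ∷ I)
  z₁<I = z₁<y₁ ∷ z₁<t ∷ All.map (<-trans z₁<t) t<I
  below : ∀ {a} → z₁ < a → All (_< a) D1
  below z₁<a = All.map (λ p → <-trans p z₁<a) D1<z₁

ascending : ℕ → ℕ → List ℕ
ascending s zero    = []
ascending s (suc n) = s ∷ ascending (suc s) n

ascending-≥ : ∀ s n → All (s ≤_) (ascending s n)
ascending-≥ s zero    = []
ascending-≥ s (suc n) = ≤-refl ∷ All.map (≤-trans (n≤1+n s)) (ascending-≥ (suc s) n)

ascending-> : ∀ {w} s n → w < s → All (w <_) (ascending s n)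
ascending-> s n w<s = All.map (<-≤-trans w<s) (ascending-≥ s n)

map-suc-ascending : ∀ s n → map suc (ascending s n) ≡ ascending (suc s) n
map-suc-ascending s zero    = refl
map-suc-ascending s (suc n) = cong (suc s ∷_) (map-suc-ascending (suc s) n)

upTo≡ascending : ∀ n → upTo n ≡ ascending 0 n
upTo≡ascending zero    = refl
upTo≡ascending (suc n) = cong (0 ∷_) (begin
  applyUpTo suc n           ≡⟨ map-upTo suc n ⟨
  map suc (upTo n)          ≡⟨ cong (map suc) (upTo≡ascending n) ⟩
  map suc (ascending 0 n)   ≡⟨ map-suc-ascending 0 n ⟩
  ascending 1 n             ∎)
  where open ≡-Reasoning

idPerm≡ascending : ∀ n → idPerm n ≡ ascending 1 n
idPerm≡ascending n = trans (cong (map suc) (upTo≡ascending n)) (map-suc-ascending 0 n)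

odds↓ evens↓ : ℕ → List ℕ
odds↓ zero     = []
odds↓ (suc j)  = 3 + j * 4 ∷ 1 + j * 4 ∷ odds↓ j
evens↓ zero    = []
evens↓ (suc j) = 4 + j * 4 ∷ 2 + j * 4 ∷ evens↓ j

odds↓-< : ∀ j → All (_< j * 4) (odds↓ j)
odds↓-< zero    = []
odds↓-< (suc j) =
  offset-< (j * 4) 3 4 ∷ offset-< (j * 4) 1 4 ∷ All.map (λ p → <-≤-trans p (m≤n+m (j * 4) 4)) (odds↓-< j)

evens↓-< : ∀ j → All (_< 1 + j * 4) (evens↓ j)
evens↓-< zero    = []
evens↓-< (suc j) =
  offset-< (j * 4) 4 5 ∷ offset-< (j * 4) 2 5 ∷ All.map (λ p → <-≤-trans p (m≤n+m (1 + j * 4) 4)) (evens↓-< j)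

odds↓-<-+ : ∀ j k → All (_< k + j * 4) (odds↓ j)
odds↓-<-+ j k = All.map (λ p → <-≤-trans p (m≤n+m (j * 4) k)) (odds↓-< j)

evens↓-<-+ : ∀ j k → All (_< suc k + j * 4) (evens↓ j)
evens↓-<-+ j k = All.map (λ p → <-≤-trans p (s≤s (m≤n+m (j * 4) k))) (evens↓-< j)

-- The machine after the first j block pairs (and the leading entry) have been read, v being the
-- smallest large entry read so far.
phase : List ℕ → ℕ → ℕ → State
phase inp j v = st inp (odds↓ j) (v ∷ evens↓ j) (ascending (suc v) (j * 2)) []

-- Pairs P_{2j+1} P_{2j+2}, …, P_{2(j+c)-1} P_{2(j+c)}; the large middle entries count down to v.
blockPairs : ℕ → ℕ → ℕ → List ℕ
blockPairs j v zero    = []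
blockPairs j v (suc c) =
  2 + j * 4 ∷ suc (c * 2 + v) ∷ 1 + j * 4 ∷ 4 + j * 4 ∷ c * 2 + v ∷ 3 + j * 4 ∷ blockPairs (suc j) v c

load↠ : ∀ x inp → st (x ∷ inp) [] [] [] [] ↠ phase inp 0 x
load↠ x inp = step-d₀ refl refl refl ◅ step-d₁ refl refl ◅ ε

blockPair↠ : ∀ j c v T → 4 + j * 4 < c * 2 + v →
             phase (blockPairs j v (suc c) ++ T) j (suc c * 2 + v) ↠
             phase (blockPairs (suc j) v c ++ T) (suc j) (c * 2 + v)
blockPair↠ j c v T x₂<y₂ =
  block₁↠ (odds↓-<-+ j 1) (evens↓-<-+ j 1) (ascending-≥ _ _)
          (n<1+n _) x₁<y₁ (n<1+n _) (offset-< b 1 4) (offset-< b 2 4) ◅◅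
  block₂↠ (odds↓-<-+ j 1) (<-trans (n<1+n _) x₁<y₁) (n<1+n _) (ascending-≥ _ _)
          (offset-< b 1 4) x₂<y₂ (offset-< b 1 3)
  where
  b : ℕ
  b = j * 4
  x₁<y₁ : 2 + b < suc (c * 2 + v)
  x₁<y₁ = <-trans (offset-< b 2 4) (<-trans x₂<y₂ (n<1+n _))

blockPairs↠ : ∀ c j v T → (j + c) * 4 < v →
              phase (blockPairs j v c ++ T) j (c * 2 + v) ↠ phase T (j + c) v
blockPairs↠ zero    j v T _ rewrite +-identityʳ j = ε
blockPairs↠ (suc c) j v T h rewrite +-suc j c =
  blockPair↠ j c v T x₂<y₂ ◅◅ blockPairs↠ c (suc j) v T h
  where
  x₂<y₂ : 4 + j * 4 < c * 2 + v
  x₂<y₂ = <-≤-trans (≤-<-trans (+-monoʳ-≤ 4 (*-monoˡ-≤ 4 (m≤m+n j c))) h) (m≤n+m v (c * 2))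

-- Once the input is exhausted, D₁ and D₂ interleave into I: 4l+4, 4l+3, …, 1 are moved in turn.
unload↠ : ∀ l c → st [] (odds↓ l) (evens↓ l) (ascending (suc (l * 4)) c) [] ↠
                  st [] [] [] (ascending 1 (l * 4 + c)) []
unload↠ zero    c = ε
unload↠ (suc l) c =
  d₂-fires (1 + b) (in-d₁ (there (here refl))) (ascending-> (5 + b) c (offset-< b 1 5))
           (offset-< b 3 4 ∷ offset-< b 1 4 ∷ odds↓-<-+ l 4) refl (ascending-> (5 + b) c (offset-< b 4 5)) ◅
  d₁-fires (1 + b) (in-d₁ (there (here refl))) (ascending-> (4 + b) (suc c) (offset-< b 1 4))
           (<⇒<ᵇ≡true (offset-< b 2 3)) ◅
  d₂-fires (1 + b) (in-d₁ (here refl)) (ascending-> (4 + b) (suc c) (offset-< b 1 4))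
           (offset-< b 1 3 ∷ odds↓-<-+ l 3) refl (ascending-> (4 + b) (suc c) (offset-< b 3 4)) ◅
  d₂-fires (1 + b) (in-d₁ (here refl)) (ascending-> (3 + b) (2 + c) (offset-< b 1 3))
           (offset-< b 1 2 ∷ odds↓-<-+ l 2) refl (ascending-> (3 + b) (2 + c) (offset-< b 2 3)) ◅
  d₁-fires (1 + b) (in-d₁ (here refl)) (ascending-> (2 + b) (3 + c) (offset-< b 1 2))
           (pushDec-true (evens↓-< l)) ◅
  d₂-fires (1 + b) (in-d₂ (here refl)) (ascending-> (2 + b) (3 + c) (offset-< b 1 2))
           (odds↓-<-+ l 1) refl (ascending-> (2 + b) (3 + c) (offset-< b 1 2)) ◅
  subst (λ n → st [] (odds↓ l) (evens↓ l) (ascending (suc b) (4 + c)) [] ↠ st [] [] [] (ascending 1 n) [])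
        shift
        (unload↠ l (4 + c))
  where
  b : ℕ
  b = l * 4
  shift : b + (4 + c) ≡ suc l * 4 + c
  shift = trans (sym (+-assoc b 4 c)) (cong (_+ c) (+-comm b 4))

drain↠ : ∀ s n O → st [] [] [] (ascending s n) O ↠ st [] [] [] [] (ascending s n ʳ++ O)
drain↠ s zero    O = ε
drain↠ s (suc n) O =
  step-d₃ (isSmallestRemaining-true s (st [] [] [] (ascending s (suc n)) O) (ascending-≥ s (suc n))) ◅
  drain↠ (suc s) n (s ∷ O)

sortable-by-↠ : ∀ π n → st π [] [] [] [] ↠ st [] [] [] (ascending 1 n) [] → n ≡ length π → QlgSortable π
sortable-by-↠ π n π↠ refl = begin
  qlgOutput π                         ≡⟨ qlgOutput-↠ π (π↠ ◅◅ drain↠ 1 n []) ⟩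
  reverse (reverse (ascending 1 n))   ≡⟨ reverse-involutive (ascending 1 n) ⟩
  ascending 1 n                       ≡⟨ idPerm≡ascending n ⟨
  idPerm n                            ∎
  where open ≡-Reasoning

unsortable-by-↠ : ∀ x π {inp D1 D2 I a} → st (x ∷ π) [] [] [] [] ↠ st inp D1 D2 I (a ∷ []) → a ≢ 1 →
                  ¬ QlgSortable (x ∷ π)
unsortable-by-↠ x π r a≢1 sorted with qlgOutput-prefix (x ∷ π) r
... | ys , output≡ = a≢1 (∷-injectiveˡ (trans (sym output≡) sorted))

∸-≡ : ∀ {a b c} → a ≡ b + c → a ∸ b ≡ c
∸-≡ {b = b} {c} refl = m+n∸m≡n b c

P-block-≡ : ∀ m i {w e} → 3 * m + 2 ≡ i + w → 2 * i ≡ suc e → P-block m i ≡ suc e ∷ w ∷ e ∷ []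
P-block-≡ m i large double rewrite double = cong (λ k → suc _ ∷ k ∷ _ ∷ []) (∸-≡ large)

P-last-≡ : ∀ m {e} → 2 * m ≡ suc e → P-last m ++ 2 * m + 2 ∷ [] ≡ suc e ∷ 2 + e ∷ e ∷ 3 + e ∷ []
P-last-≡ m {e} double rewrite double =
  cong₂ (λ k l → suc e ∷ k ∷ e ∷ l ∷ []) (+-comm (suc e) 1) (+-comm (suc e) 2)

concatMap-P-blocks : ∀ {m} c j r v → 3 * m + 2 ≡ j * 2 + (c * 2 + v) →
  concatMap (P-block m) (ascending (suc (j * 2)) (c * 2 + r)) ≡
  blockPairs j v c ++ concatMap (P-block m) (ascending (suc ((j + c) * 2)) r)
concatMap-P-blocks zero    j r v _ rewrite +-identityʳ j = refl
concatMap-P-blocks {m} (suc c) j r v large rewrite +-suc j c =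
  cong₂ _++_ (P-block-≡ m (suc (j * 2)) large₁ (double₁ j))
    (cong₂ _++_ (P-block-≡ m (suc (suc (j * 2))) large₂ (double₂ j))
                (concatMap-P-blocks {m} c (suc j) r v large₂))
  where
  u : ℕ
  u = c * 2 + v
  large₁ : 3 * m + 2 ≡ suc (j * 2) + suc u
  large₁ = trans large (+-suc (j * 2) (suc u))
  large₂ : 3 * m + 2 ≡ suc (suc (j * 2)) + u
  large₂ = trans large₁ (cong suc (+-suc (j * 2) u))
  double₁ : ∀ j → 2 * suc (j * 2) ≡ suc (1 + j * 4)
  double₁ = solve-∀
  double₂ : ∀ j → 2 * suc (suc (j * 2)) ≡ suc (3 + j * 4)
  double₂ = solve-∀

gamma-≡ : ∀ m K r v → m ∸ 1 ≡ K * 2 + r → 3 * m + 2 ≡ K * 2 + v →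
          gamma m ≡ K * 2 + v ∷ blockPairs 0 v K ++
                      concatMap (P-block m) (ascending (suc (K * 2)) r) ++ P-last m ++ 2 * m + 2 ∷ []
gamma-≡ m K r v m-1 large = cong₂ _∷_ large (begin
  concatMap (P-block m) (map suc (upTo (m ∸ 1))) ++ rest
    ≡⟨ cong (λ n → concatMap (P-block m) n ++ rest)
            (trans (idPerm≡ascending (m ∸ 1)) (cong (ascending 1) m-1)) ⟩
  concatMap (P-block m) (ascending 1 (K * 2 + r)) ++ rest
    ≡⟨ cong (_++ rest) (concatMap-P-blocks {m} K 0 r v large) ⟩
  (blockPairs 0 v K ++ concatMap (P-block m) (ascending (suc (K * 2)) r)) ++ rest
    ≡⟨ ++-assoc (blockPairs 0 v K) _ rest ⟩
  blockPairs 0 v K ++ concatMap (P-block m) (ascending (suc (K * 2)) r) ++ rest ∎)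
  where
  open ≡-Reasoning
  rest : List ℕ
  rest = P-last m ++ 2 * m + 2 ∷ []

length-concatMap-P-block : ∀ m xs → length (concatMap (P-block m) xs) ≡ length xs * 3
length-concatMap-P-block m []       = refl
length-concatMap-P-block m (x ∷ xs) = cong (3 +_) (length-concatMap-P-block m xs)

length-gamma : ∀ n → length (gamma (suc n)) ≡ 3 * suc n + 2
length-gamma n = begin
  length (gamma (suc n))   ≡⟨ cong suc (length-++ blocks) ⟩
  suc (length blocks + 4)  ≡⟨ cong (λ k → suc (k + 4)) (length-concatMap-P-block (suc n) xs) ⟩
  suc (length xs * 3 + 4)  ≡⟨ cong (λ k → suc (k * 3 + 4)) (trans (length-map suc (upTo n)) (length-upTo n)) ⟩
  suc (n * 3 + 4)          ≡⟨ arith n ⟩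
  3 * suc n + 2            ∎
  where
  open ≡-Reasoning
  xs : List ℕ
  xs = map suc (upTo n)
  blocks : List ℕ
  blocks = concatMap (P-block (suc n)) xs
  arith : ∀ n → suc (n * 3 + 4) ≡ 3 * suc n + 2
  arith = solve-∀

-- The input left after the block pairs: P_{m-1} P_m (2m+2) for m = 2K + 2, and P_m (2m+2) for m = 2K + 1.
evenTail oddTail : ℕ → List ℕ
evenTail K = 2 + K * 4 ∷ 7 + K * 4 ∷ 1 + K * 4 ∷ 4 + K * 4 ∷ 5 + K * 4 ∷ 3 + K * 4 ∷ 6 + K * 4 ∷ []
oddTail  K = 2 + K * 4 ∷ 3 + K * 4 ∷ 1 + K * 4 ∷ 4 + K * 4 ∷ []

gamma-even-≡ : ∀ K → gamma (suc K * 2) ≡ K * 2 + (8 + K * 4) ∷ blockPairs 0 (8 + K * 4) K ++ evenTail K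
gamma-even-≡ K = trans (gamma-≡ m K 1 (8 + K * 4) (+-comm 1 (K * 2)) (large K))
  (cong (λ t → K * 2 + (8 + K * 4) ∷ blockPairs 0 (8 + K * 4) K ++ t)
        (cong₂ _++_ (cong (_++ []) (P-block-≡ m (suc (K * 2)) (large′ K) (double K)))
                    (P-last-≡ m (double′ K))))
  where
  m : ℕ
  m = suc K * 2
  large : ∀ K → 3 * (suc K * 2) + 2 ≡ K * 2 + (8 + K * 4)
  large = solve-∀
  large′ : ∀ K → 3 * (suc K * 2) + 2 ≡ suc (K * 2) + (7 + K * 4)
  large′ = solve-∀
  double : ∀ K → 2 * suc (K * 2) ≡ suc (1 + K * 4)
  double = solve-∀
  double′ : ∀ K → 2 * (suc K * 2) ≡ suc (3 + K * 4)
  double′ = solve-∀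

gamma-odd-≡ : ∀ K → gamma (1 + K * 2) ≡ K * 2 + (5 + K * 4) ∷ blockPairs 0 (5 + K * 4) K ++ oddTail K
gamma-odd-≡ K = trans (gamma-≡ (1 + K * 2) K 0 (5 + K * 4) (sym (+-identityʳ (K * 2))) (large K))
  (cong (λ t → K * 2 + (5 + K * 4) ∷ blockPairs 0 (5 + K * 4) K ++ t) (P-last-≡ (1 + K * 2) (double K)))
  where
  large : ∀ K → 3 * (1 + K * 2) + 2 ≡ K * 2 + (5 + K * 4)
  large = solve-∀
  double : ∀ K → 2 * (1 + K * 2) ≡ suc (1 + K * 4)
  double = solve-∀

evenTail↠ : ∀ K → let b = K * 4 in
            phase (evenTail K) K (8 + b) ↠
            st [] (odds↓ (suc K)) (evens↓ (suc K)) (ascending (5 + b) (4 + K * 2)) []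
evenTail↠ K =
  block₁↠ (odds↓-<-+ K 1) (evens↓-<-+ K 1) (ascending-≥ _ _)
          (n<1+n _) (offset-< b 2 7) (n<1+n _) (offset-< b 1 4) (offset-< b 2 4) ◅◅
  block₂↠ (odds↓-<-+ K 1) (offset-< b 1 7) (n<1+n _) (ascending-≥ _ _)
          (offset-< b 1 4) (offset-< b 4 5) (offset-< b 1 3) ◅◅
  d₀-fires (1 + b) (in-d₁ (there (here refl))) (1+b< 7 (2 + K * 2)) (D1< 5) (D1< 6) ◅
  d₁-fires (1 + b) (in-d₁ (there (there (here refl)))) (1+b< 7 (2 + K * 2)) (<⇒<ᵇ≡true (offset-< b 5 6)) ◅
  d₂-fires (1 + b) (in-d₁ (there (here refl))) (1+b< 7 (2 + K * 2)) (D1< 6) refl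
           (ascending-> (7 + b) (2 + K * 2) (offset-< b 6 7)) ◅
  d₂-fires (1 + b) (in-d₁ (there (here refl))) (1+b< 6 (3 + K * 2)) (D1< 5) refl
           (ascending-> (6 + b) (3 + K * 2) (offset-< b 5 6)) ◅
  ε
  where
  b : ℕ
  b = K * 4
  1+b< : ∀ k n → {T (1 <ᵇ k)} → All (1 + b <_) (ascending (k + b) n)
  1+b< k n {1<k} = ascending-> (k + b) n (offset-< b 1 k {1<k})
  D1< : ∀ k → {T (3 <ᵇ k)} → All (_< k + b) (odds↓ (suc K))
  D1< k {3<k} = offset-< b 3 k {3<k} ∷ <-trans (offset-< b 1 3) (offset-< b 3 k {3<k}) ∷ odds↓-<-+ K k

gamma-even-sortable : ∀ K → QlgSortable (gamma (suc K * 2))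
gamma-even-sortable K = sortable-by-↠ (gamma (suc K * 2)) n
  (subst (λ π → st π [] [] [] [] ↠ st [] [] [] (ascending 1 n) []) (sym (gamma-even-≡ K))
    (load↠ _ _ ◅◅ blockPairs↠ K 0 v (evenTail K) (offset-< (K * 4) 0 8) ◅◅
     evenTail↠ K ◅◅ unload↠ (suc K) (4 + K * 2)))
  (trans (arith K) (sym (length-gamma (suc (K * 2)))))
  where
  v : ℕ
  v = 8 + K * 4
  n : ℕ
  n = suc K * 4 + (4 + K * 2)
  arith : ∀ K → suc K * 4 + (4 + K * 2) ≡ 3 * suc (suc (K * 2)) + 2
  arith = solve-∀

gamma-odd-unsortable : ∀ K → ¬ QlgSortable (gamma (1 + K * 2))
gamma-odd-unsortable K sorted =
  unsortable-by-↠ _ _ trace (λ ()) (subst QlgSortable (gamma-odd-≡ K) sorted)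
  where
  b : ℕ
  b = K * 4
  trace : st (K * 2 + (5 + b) ∷ blockPairs 0 (5 + b) K ++ oddTail K) [] [] [] [] ↠
          st [] (1 + b ∷ odds↓ K) (4 + b ∷ 2 + b ∷ evens↓ K) (ascending (5 + b) (suc (K * 2))) (3 + b ∷ [])
  trace = load↠ _ _ ◅◅ blockPairs↠ K 0 (5 + b) (oddTail K) (offset-< b 0 5) ◅◅
        block₁↠ (odds↓-<-+ K 1) (evens↓-<-+ K 1) (ascending-≥ _ _)
                (n<1+n _) (n<1+n _) (offset-< b 3 5) (offset-< b 1 4) (offset-< b 2 4) ◅◅
        d₃-forced-fires (1 + b) (in-d₁ (here refl))
                        (offset-< b 1 3 ∷ ascending-> (5 + b) (suc (K * 2)) (offset-< b 1 5))
                        (≥⇒<ᵇ≡false (<⇒≤ (offset-< b 1 4))) refl (≥⇒<ᵇ≡false (<⇒≤ (offset-< b 3 4))) ◅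
        ε

-- Patterns

strictMono⇒reflects-< : ∀ {f : ℕ → ℕ} → f Preserves _<_ ⟶ _<_ → ∀ {v w} → f v < f w → v < w
strictMono⇒reflects-< mono {v} {w} fv<fw with <-cmp v w
... | tri< v<w _ _    = v<w
... | tri≈ _ refl _   = ⊥-elim (<-irrefl refl fv<fw)
... | tri> _ _ w<v    = ⊥-elim (<-asym fv<fw (mono w<v))

lookup-map-cast : ∀ (f : ℕ → ℕ) σ (eq : length σ ≡ length (map f σ)) i →
                  lookup (map f σ) (cast eq i) ≡ f (lookup σ i)
lookup-map-cast f (x ∷ σ) eq Fin.zero    = refl
lookup-map-cast f (x ∷ σ) eq (Fin.suc i) = lookup-map-cast f σ (suc-injective eq) i

orderIso-map : ∀ {f : ℕ → ℕ} → f Preserves _<_ ⟶ _<_ → ∀ σ → OrderIso σ (map f σ)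
orderIso-map {f} mono σ = eq , λ i j →
  subst₂ (λ a b → (lookup σ i < lookup σ j) ⇔ (a < b))
         (sym (lookup-map-cast f σ eq i)) (sym (lookup-map-cast f σ eq j))
         (mk⇔ mono (strictMono⇒reflects-< mono))
  where
  eq : length σ ≡ length (map f σ)
  eq = sym (length-map f σ)

-- punchIn k v leaves the value k unused, as Data.Fin.punchIn does on Fin.
punchIn : ℕ → ℕ → ℕ
punchIn k v = if v <ᵇ k then v else suc v

punchIn-< : ∀ {k v} → v < k → punchIn k v ≡ v
punchIn-< v<k rewrite <⇒<ᵇ≡true v<k = refl

punchIn-≥ : ∀ {k v} → k ≤ v → punchIn k v ≡ suc v
punchIn-≥ k≤v rewrite ≥⇒<ᵇ≡false k≤v = refl

punchIn-mono-< : ∀ k → punchIn k Preserves _<_ ⟶ _<_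
punchIn-mono-< k {v} {w} v<w with v <? k | w <? k
... | yes v<k | yes w<k rewrite punchIn-< v<k | punchIn-< w<k = v<w
... | yes v<k | no  w≮k rewrite punchIn-< v<k | punchIn-≥ (≮⇒≥ w≮k) = m<n⇒m<1+n v<w
... | no  v≮k | yes w<k = ⊥-elim (v≮k (<-trans v<w w<k))
... | no  v≮k | no  w≮k rewrite punchIn-≥ (≮⇒≥ v≮k) | punchIn-≥ (≮⇒≥ w≮k) = s<s v<w

embed : ℕ → ℕ → ℕ
embed n = punchIn (7 + 2 * n) ∘ punchIn (2 + 2 * n) ∘ punchIn (1 + 2 * n)

embed-mono-< : ∀ n → embed n Preserves _<_ ⟶ _<_
embed-mono-< n = punchIn-mono-< (7 + 2 * n) ∘ punchIn-mono-< (2 + 2 * n) ∘ punchIn-mono-< (1 + 2 * n)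

module _ (n : ℕ) where

  private
    p₂ p₇ : ℕ → ℕ
    p₂ = punchIn (2 + 2 * n)
    p₇ = punchIn (7 + 2 * n)

  embed-low : ∀ {v} → v ≤ 2 * n → embed n v ≡ v
  embed-low {v} v≤2n = begin
    embed n v  ≡⟨ cong (p₇ ∘ p₂) (punchIn-< (s≤s v≤2n)) ⟩
    p₇ (p₂ v)  ≡⟨ cong p₇ (punchIn-< (m<n⇒m<1+n (s≤s v≤2n))) ⟩
    p₇ v       ≡⟨ punchIn-< (<-≤-trans (s≤s v≤2n) (m≤n+m _ 6)) ⟩
    v          ∎
    where open ≡-Reasoning

  embed-mid : ∀ {v} → 2 * n < v → v < 5 + 2 * n → embed n v ≡ 2 + v
  embed-mid {v} 2n<v v<5+2n = begin
    embed n v        ≡⟨ cong (p₇ ∘ p₂) (punchIn-≥ 2n<v) ⟩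
    p₇ (p₂ (1 + v))  ≡⟨ cong p₇ (punchIn-≥ (s≤s 2n<v)) ⟩
    p₇ (2 + v)       ≡⟨ punchIn-< (s≤s (s≤s v<5+2n)) ⟩
    2 + v            ∎
    where open ≡-Reasoning

  embed-high : ∀ {v} → 5 + 2 * n ≤ v → embed n v ≡ 3 + v
  embed-high {v} 5+2n≤v = begin
    embed n v        ≡⟨ cong (p₇ ∘ p₂) (punchIn-≥ 1+2n≤v) ⟩
    p₇ (p₂ (1 + v))  ≡⟨ cong p₇ (punchIn-≥ (s≤s 1+2n≤v)) ⟩
    p₇ (2 + v)       ≡⟨ punchIn-≥ (s≤s (s≤s 5+2n≤v)) ⟩
    3 + v            ∎
    where
    open ≡-Reasoning
    1+2n≤v : 1 + 2 * n ≤ v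
    1+2n≤v = ≤-trans (m≤n+m (1 + 2 * n) 4) 5+2n≤v

large-entry-arith : ∀ n → 5 + 2 * n + n ≡ 3 * suc n + 2
large-entry-arith = solve-∀

large-entry-≥ : ∀ n {i} → i ≤ n → 5 + 2 * n ≤ 3 * suc n + 2 ∸ i
large-entry-≥ n {i} i≤n = begin
  5 + 2 * n              ≡⟨ m+n∸n≡m (5 + 2 * n) n ⟨
  5 + 2 * n + n ∸ n      ≤⟨ ∸-monoʳ-≤ (5 + 2 * n + n) i≤n ⟩
  5 + 2 * n + n ∸ i      ≡⟨ cong (_∸ i) (large-entry-arith n) ⟩
  3 * suc n + 2 ∸ i      ∎
  where open ≤-Reasoning

embed-large-entry : ∀ n {i} → i ≤ n → embed n (3 * suc n + 2 ∸ i) ≡ 3 * suc (suc n) + 2 ∸ i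
embed-large-entry n {i} i≤n = begin
  embed n (3 * suc n + 2 ∸ i)   ≡⟨ embed-high n (large-entry-≥ n i≤n) ⟩
  3 + (3 * suc n + 2 ∸ i)       ≡⟨ +-∸-assoc 3 i≤large ⟨
  3 + (3 * suc n + 2) ∸ i       ≡⟨ cong (_∸ i) (arith n) ⟩
  3 * suc (suc n) + 2 ∸ i       ∎
  where
  open ≡-Reasoning
  i≤large : i ≤ 3 * suc n + 2
  i≤large = ≤-trans i≤n (subst (n ≤_) (large-entry-arith n) (m≤n+m n (5 + 2 * n)))
  arith : ∀ n → 3 + (3 * suc n + 2) ≡ 3 * suc (suc n) + 2
  arith = solve-∀

map-embed-P-blocks : ∀ n xs → All (_≤ n) xs →
                     map (embed n) (concatMap (P-block (suc n)) xs) ≡ concatMap (P-block (suc (suc n))) xs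
map-embed-P-blocks n []       []           = refl
map-embed-P-blocks n (i ∷ xs) (i≤n ∷ xs≤n) =
  cong₂ _∷_ (embed-low n 2i≤2n) (cong₂ _∷_ (embed-large-entry n i≤n)
    (cong₂ _∷_ (embed-low n (≤-trans (m∸n≤m (2 * i) 1) 2i≤2n)) (map-embed-P-blocks n xs xs≤n)))
  where
  2i≤2n : 2 * i ≤ 2 * n
  2i≤2n = *-monoʳ-≤ 2 i≤n

map-embed-P-last : ∀ n → map (embed n) (P-last (suc n) ++ 2 * suc n + 2 ∷ []) ≡
                         P-last (suc (suc n)) ++ 2 * suc (suc n) + 2 ∷ []
map-embed-P-last n = begin
  map (embed n) (P-last (suc n) ++ 2 * suc n + 2 ∷ [])
    ≡⟨ cong (map (embed n)) (P-last-≡ (suc n) (double₁ n)) ⟩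
  map (embed n) (2 + 2 * n ∷ 3 + 2 * n ∷ 1 + 2 * n ∷ 4 + 2 * n ∷ [])
    ≡⟨ cong₂ _∷_ (mid 2) (cong₂ _∷_ (mid 3) (cong₂ _∷_ (mid 1) (cong₂ _∷_ (mid 4) refl))) ⟩
  4 + 2 * n ∷ 5 + 2 * n ∷ 3 + 2 * n ∷ 6 + 2 * n ∷ []
    ≡⟨ P-last-≡ (suc (suc n)) (double₂ n) ⟨
  P-last (suc (suc n)) ++ 2 * suc (suc n) + 2 ∷ [] ∎
  where
  open ≡-Reasoning
  mid : ∀ k → {T (0 <ᵇ k)} → {T (k <ᵇ 5)} → embed n (k + 2 * n) ≡ 2 + (k + 2 * n)
  mid k {0<k} {k<5} = embed-mid n (offset-< (2 * n) 0 k {0<k}) (offset-< (2 * n) k 5 {k<5})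
  double₁ : ∀ n → 2 * suc n ≡ suc (1 + 2 * n)
  double₁ = solve-∀
  double₂ : ∀ n → 2 * suc (suc n) ≡ suc (3 + 2 * n)
  double₂ = solve-∀

gamma-pattern : ∀ n → IsPattern (gamma (suc n)) (gamma (suc (suc n)))
gamma-pattern n =
  map (embed n) (gamma (suc n)) ,
  subst₂ _⊆_ (sym image≡) (sym target≡)
         (refl ∷ ++⁺ ⊆-refl (++⁺ˡ (P-block (suc (suc n)) (suc n)) ⊆-refl)) ,
  orderIso-map (embed-mono-< n) (gamma (suc n))
  where
  xs : List ℕ
  xs = map suc (upTo n)
  B′ : List ℕ
  B′ = concatMap (P-block (suc (suc n))) xs
  L′ : List ℕ
  L′ = P-last (suc (suc n)) ++ 2 * suc (suc n) + 2 ∷ []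
  xs≤n : All (_≤ n) xs
  xs≤n = subst (All (_≤ n)) (sym (map-upTo suc n)) (applyUpTo⁺₁ suc n (λ i<n → i<n))
  image≡ : map (embed n) (gamma (suc n)) ≡ 3 * suc (suc n) + 2 ∷ B′ ++ L′
  image≡ = cong₂ _∷_ (embed-large-entry n z≤n)
    (trans (map-++ (embed n) (concatMap (P-block (suc n)) xs) _)
           (cong₂ _++_ (map-embed-P-blocks n xs xs≤n) (map-embed-P-last n)))
  target≡ : gamma (suc (suc n)) ≡ 3 * suc (suc n) + 2 ∷ B′ ++ P-block (suc (suc n)) (suc n) ++ L′
  target≡ = cong (3 * suc (suc n) + 2 ∷_) (begin
    concatMap (P-block (suc (suc n))) (map suc (upTo (suc n))) ++ L′
      ≡⟨ cong (λ ys → concatMap (P-block (suc (suc n))) ys ++ L′)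
              (trans (cong (map suc) (sym (upTo-∷ʳ n))) (map-++ suc (upTo n) (n ∷ []))) ⟩
    concatMap (P-block (suc (suc n))) (xs ++ suc n ∷ []) ++ L′
      ≡⟨ cong (_++ L′) (concatMap-++ (P-block (suc (suc n))) xs (suc n ∷ [])) ⟩
    (B′ ++ P-block (suc (suc n)) (suc n) ++ []) ++ L′
      ≡⟨ ++-assoc B′ _ L′ ⟩
    B′ ++ P-block (suc (suc n)) (suc n) ++ L′ ∎)
    where open ≡-Reasoning

data Parity : ℕ → Set where
  even : ∀ K → Parity (K * 2)
  odd  : ∀ K → Parity (1 + K * 2)

parity : ∀ n → Parity n
parity zero    = even 0
parity (suc n) with parity n
... | even K = odd K
... | odd  K = even (suc K)

2∤1+K*2 : ∀ K → ¬ 2 ∣ 1 + K * 2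
2∤1+K*2 K 2∣odd with ∣1⇒≡1 (∣m+n∣m⇒∣n (subst (2 ∣_) (+-comm 1 (K * 2)) 2∣odd) (n∣m*n K))
... | ()

proposition6 :
    ((i : ℕ) → 1 ≤ i → IsPattern (gamma i) (gamma (suc i)))
    × ((i : ℕ) → 1 ≤ i → (QlgSortable (gamma i) ⇔ (2 ∣ i)))
proposition6 = (λ { (suc n) _ → gamma-pattern n }) , sortable⇔even
  where
  sortable⇔even : (i : ℕ) → 1 ≤ i → QlgSortable (gamma i) ⇔ (2 ∣ i)
  sortable⇔even i 1≤i with parity i
  ... | even zero    = ⊥-elim (<-irrefl refl 1≤i)
  ... | even (suc K) = mk⇔ (λ _ → divides (suc K) refl) (λ _ → gamma-even-sortable K)
  ... | odd  K       = mk⇔ (⊥-elim ∘ gamma-odd-unsortable K) (⊥-elim ∘ 2∤1+K*2 K)
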